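{- Let $\mathscr M=(S,\mathcal P(S),\mathtt{bel},\mathtt{pl},v^+,v^-)$ be a $\mathsf{DS}_{\mathtt{pl}}$ model. Then $\mathtt{bel}^+$ (resp. $\mathtt{pl}^+$) is a general belief (resp. general plausibility) function on the Lindenbaum algebra $\mathcal L_{\mathsf{BD}}$, and $\mathtt{bel}^-$ (resp. $\mathtt{pl}^-$) is a general belief (resp. general plausibility) function on the dual $\mathcal L_{\mathsf{BD}}^{op}$ of the Lindenbaum algebra.
   Context: $\mathscr{L}_{\mathsf{BD}}$: formulas over a finite set $\mathtt{Prop}$ with $\neg,\wedge,\vee$. A BD model $\langle S,v^+,v^-\rangle$ has support relations $\vDash^\pm$ ($w\vDash^\pm p$ iff $w\in v^\pm(p)$; $w\vDash^\pm\neg\varphi$ iff $w\vDash^\mp\varphi$; $\vDash^+$ classical on $\wedge,\vee$; $w\vDash^-\varphi\wedge\psi$ iff $w\vDash^-\varphi$ or $w\vDash^-\psi$; $w\vDash^-\varphi\vee\psi$ iff both), $|\varphi|^\pm=\{w:w\vDash^\pm\varphi\}$. $\varphi\vdash_{\mathsf{BD}}\psi$ iff in all BD models $|\varphi|^+\subseteq|\psi|^+$ and $|\psi|^-\subseteq|\varphi|^-$. The Lindenbaum algebra $\mathcal L_{\mathsf{BD}}$ is $\mathscr{L}_{\mathsf{BD}}$ modulo mutual entailment, a De Morgan algebra ordered by $[\varphi]\le[\psi]$ iff $\varphi\vdash_{\mathsf{BD}}\psi$, with $[\varphi]\wedge[\psi]=[\varphi\wedge\psi]$, $[\varphi]\vee[\psi]=[\varphi\vee\psi]$;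 $\mathcal L_{\mathsf{BD}}^{op}$ is the same set with reversed order (meets and joins swapped). A $\mathsf{DS}_{\mathtt{pl}}$ model is a BD model $\langle S,v^+,v^-\rangle$ together with a belief function $\mathtt{bel}$ and a plausibility function $\mathtt{pl}$ on the powerset $\mathcal P(S)$ (belief: monotone, $\mathtt{bel}(\bigcup_{i\le k}A_i)\ge\sum_{\varnothing\ne J}(-1)^{|J|+1}\mathtt{bel}(\bigcap_{j\in J}A_j)$, $\mathtt{bel}(\varnothing)=0$, $\mathtt{bel}(S)=1$; plausibility: monotone, $\mathtt{pl}(\bigcap_{i\le k}A_i)\le\sum_{\varnothing\ne J}(-1)^{|J|+1}\mathtt{pl}(\bigcup_{j\in J}A_j)$, $\mathtt{pl}(\varnothing)=0$, $\mathtt{pl}(S)=1$). Define $\mathtt{bel}^\pm(\varphi)=\mathtt{bel}(|\varphi|^\pm)$ and $\mathtt{pl}^\pm(\varphi)=\mathtt{pl}(|\varphi|^\pm)$ (well defined on equivalence classes). A general belief function on a lattice $L$ is a monotone $b:L\to[0,1]$ with $b(\bigvee_{i=1}^ka_i)\ge\sum_{\varnothing\ne J\subseteq\{1..k\}}(-1)^{|J|+1}b(\bigwedge_{j\in J}a_j)$ for all $k\ge1$; a general plausibility function is a monotone $q:L\to[0,1]$ with $q(\bigwedge_{i=1}^ka_i)\le\sum_{\varnothing\ne J}(-1)^{|J|+1}q(\bigvee_{j\in J}a_j)$ for all $k\ge1$. -}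

module Defs where

open import Level using (Level; _⊔_; 0ℓ) renaming (suc to lsuc)
open import Data.Nat using (ℕ; zero; suc)
open import Data.Fin using (Fin; zero; suc)
open import Data.Fin.Subset using (Subset; Side; inside; outside; ∣_∣)
open import Data.Vec using ([]; _∷_)
open import Data.List using (List; []; _∷_; map; _++_; foldr)
open import Data.Maybe using (Maybe; just; nothing; maybe)
open import Data.Product using (_×_)
open import Data.Sum using (_⊎_)
open import Data.Bool using (if_then_else_)
open import Data.Bool using (Bool; true; false; not)
open import Relation.Unary using (Pred; _⊆_; _∩_; _∪_; ∅; U)
open import Relation.Binary.Structures using (IsPartialOrder)
open import Algebra.Bundles using (CommutativeRing)

-- Scalars: an ordered commutative ring (the reals are an instance).

record OrderedCommRing (c ℓ ℓ' : Level) : Set (lsuc (c ⊔ ℓ ⊔ ℓ')) where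
  field
    commutativeRing : CommutativeRing c ℓ
  open CommutativeRing commutativeRing public
  field
    _≤_            : Carrier → Carrier → Set ℓ'
    isPartialOrder : IsPartialOrder _≈_ _≤_
    total          : ∀ x y → (x ≤ y) ⊎ (y ≤ x)
    +-monoˡ        : ∀ {x y} z → x ≤ y → (x + z) ≤ (y + z)
    *-nonneg       : ∀ {x y} → 0# ≤ x → 0# ≤ y → 0# ≤ (x * y)
    0≤1            : 0# ≤ 1#

allSubsets : (k : ℕ) → List (Subset k)
allSubsets zero    = [] ∷ []
allSubsets (suc k) = map (inside ∷_) (allSubsets k) ++ map (outside ∷_) (allSubsets k)

bigOp : ∀ {a} {A : Set a} {k : ℕ} → (A → A → A) → (Fin k → A) → Subset k → Maybe A
bigOp {k = zero}  op f []       = nothing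
bigOp {k = suc k} op f (inside ∷ p) =
  just (maybe (op (f zero)) (f zero) (bigOp op (λ i → f (suc i)) p))
bigOp {k = suc k} op f (outside ∷ p) = bigOp op (λ i → f (suc i)) p

fold1 : ∀ {a} {A : Set a} {k : ℕ} → (A → A → A) → (Fin (suc k) → A) → A
fold1 {k = zero}  op f = f zero
fold1 {k = suc k} op f = op (f zero) (fold1 op (λ i → f (suc i)))

record LatticeSig (a ℓ : Level) : Set (lsuc (a ⊔ ℓ)) where
  field
    Carrier : Set a
    _≤_     : Carrier → Carrier → Set ℓ
    _∧_     : Carrier → Carrier → Carrier
    _∨_     : Carrier → Carrier → Carrier

isEven : ℕ → Bool
isEven zero    = true
isEven (suc m) = not (isEven m)

module _ {c ℓ ℓ'} (R : OrderedCommRing c ℓ ℓ') where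
  open OrderedCommRing R renaming (_≤_ to _≤R_; Carrier to ℝ)

  sign : ∀ {k} → Subset k → ℝ
  sign J = if isEven ∣ J ∣ then - 1# else 1#

  -- Σ_{∅ ≠ J ⊆ {1..k}} (-1)^{|J|+1} g(op_{j∈J} f j)
  incExc : ∀ {a} {A : Set a} {k : ℕ} → (A → A → A) → (A → ℝ) → (Fin k → A) → ℝ
  incExc {k = k} op g f =
    foldr _+_ 0# (map (λ J → maybe (λ x → sign J * g x) 0# (bigOp op f J)) (allSubsets k))

  module _ {a ℓL} (L : LatticeSig a ℓL) where
    open LatticeSig L

    InUnit : (Carrier → ℝ) → Set (a ⊔ ℓ')
    InUnit b = ∀ x → (0# ≤R b x) × (b x ≤R 1#)

    Monotone : (Carrier → ℝ) → Set (a ⊔ ℓL ⊔ ℓ')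
    Monotone b = ∀ x y → x ≤ y → b x ≤R b y

    IsGeneralBelief : (Carrier → ℝ) → Set (a ⊔ ℓL ⊔ ℓ')
    IsGeneralBelief b = InUnit b × Monotone b ×
      (∀ k (f : Fin (suc k) → Carrier) → incExc _∧_ b f ≤R b (fold1 _∨_ f))

    IsGeneralPlausibility : (Carrier → ℝ) → Set (a ⊔ ℓL ⊔ ℓ')
    IsGeneralPlausibility q = InUnit q × Monotone q ×
      (∀ k (f : Fin (suc k) → Carrier) → q (fold1 _∧_ f) ≤R incExc _∨_ q f)

PowersetL : (S : Set) → LatticeSig (lsuc 0ℓ) 0ℓ
PowersetL S = record { Carrier = Pred S 0ℓ ; _≤_ = _⊆_ ; _∧_ = _∩_ ; _∨_ = _∪_ }

data Formula (n : ℕ) : Set where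
  atom : Fin n → Formula n
  ¬'_  : Formula n → Formula n
  _∧'_ : Formula n → Formula n → Formula n
  _∨'_ : Formula n → Formula n → Formula n

mutual
  sat⁺ : ∀ {n} {S : Set} → (Fin n → Pred S 0ℓ) → (Fin n → Pred S 0ℓ) → Formula n → Pred S 0ℓ
  sat⁺ v⁺ v⁻ (atom p)  = v⁺ p
  sat⁺ v⁺ v⁻ (¬' φ)    = sat⁻ v⁺ v⁻ φ
  sat⁺ v⁺ v⁻ (φ ∧' ψ)  = sat⁺ v⁺ v⁻ φ ∩ sat⁺ v⁺ v⁻ ψ
  sat⁺ v⁺ v⁻ (φ ∨' ψ)  = sat⁺ v⁺ v⁻ φ ∪ sat⁺ v⁺ v⁻ ψ

  sat⁻ : ∀ {n} {S : Set} → (Fin n → Pred S 0ℓ) → (Fin n → Pred S 0ℓ) → Formula n → Pred S 0ℓ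
  sat⁻ v⁺ v⁻ (atom p)  = v⁻ p
  sat⁻ v⁺ v⁻ (¬' φ)    = sat⁺ v⁺ v⁻ φ
  sat⁻ v⁺ v⁻ (φ ∧' ψ)  = sat⁻ v⁺ v⁻ φ ∪ sat⁻ v⁺ v⁻ ψ
  sat⁻ v⁺ v⁻ (φ ∨' ψ)  = sat⁻ v⁺ v⁻ φ ∩ sat⁻ v⁺ v⁻ ψ

_⊢BD_ : ∀ {n} → Formula n → Formula n → Set₁
_⊢BD_ {n} φ ψ = ∀ (S : Set) (v⁺ v⁻ : Fin n → Pred S 0ℓ) →
  (sat⁺ v⁺ v⁻ φ ⊆ sat⁺ v⁺ v⁻ ψ) × (sat⁻ v⁺ v⁻ ψ ⊆ sat⁻ v⁺ v⁻ φ)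

-- Lindenbaum algebra, presented on representatives (functions on classes
-- = functions on formulas; meets/joins of classes are classes of ∧', ∨')
LindenbaumL : ℕ → LatticeSig 0ℓ (lsuc 0ℓ)
LindenbaumL n = record { Carrier = Formula n ; _≤_ = _⊢BD_ ; _∧_ = _∧'_ ; _∨_ = _∨'_ }

LindenbaumOpL : ℕ → LatticeSig 0ℓ (lsuc 0ℓ)
LindenbaumOpL n = record { Carrier = Formula n ; _≤_ = λ φ ψ → ψ ⊢BD φ ; _∧_ = _∨'_ ; _∨_ = _∧'_ }

record DSplModel {c ℓ ℓ'} (R : OrderedCommRing c ℓ ℓ') (n : ℕ) : Set (lsuc 0ℓ ⊔ c ⊔ ℓ ⊔ ℓ') where
  open OrderedCommRing R using (_≈_; 0#; 1#) renaming (Carrier to ℝ)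
  field
    S        : Set
    v⁺ v⁻    : Fin n → Pred S 0ℓ
    bel pl   : Pred S 0ℓ → ℝ
    bel-gen  : IsGeneralBelief R (PowersetL S) bel
    bel-∅    : bel ∅ ≈ 0#
    bel-S    : bel U ≈ 1#
    pl-gen   : IsGeneralPlausibility R (PowersetL S) pl
    pl-∅     : pl ∅ ≈ 0#
    pl-S     : pl U ≈ 1#

  bel⁺ bel⁻ pl⁺ pl⁻ : Formula n → ℝ
  bel⁺ φ = bel (sat⁺ v⁺ v⁻ φ)
  bel⁻ φ = bel (sat⁻ v⁺ v⁻ φ)
  pl⁺ φ  = pl (sat⁺ v⁺ v⁻ φ)
  pl⁻ φ  = pl (sat⁻ v⁺ v⁻ φ)

-- The positive and negative extensions |_|⁺ and |_|⁻ are lattice homomorphisms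
-- from formulas into P(S), for the Lindenbaum order and its dual respectively:
-- they send ∧ and ∨ to ∩ and ∪ (for |_|⁻ the roles of ∧ and ∨ are swapped,
-- which is exactly what the dual algebra records), and BD-entailment gives
-- inclusion. Pulling a general belief or plausibility function on P(S) back
-- along such a monotone homomorphism preserves the range, monotonicity, and
-- each inclusion–exclusion inequality term by term.
module Submission where

open import Defs
open import Level using (_⊔_; 0ℓ) renaming (suc to lsuc)
open import Function using (_∘_)
open import Data.Nat using (ℕ; zero; suc)
open import Data.Product using (_×_; _,_; proj₁; proj₂)
open import Data.Fin using (Fin; zero; suc)
open import Data.Fin.Subset using (Subset; inside; outside)
open import Data.Vec using ([]; _∷_)
open import Data.List using (foldr)
open import Data.List.Properties using (map-cong)
open import Data.Maybe using (Maybe; just; nothing; maybe′)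
import Data.Maybe as Maybe
open import Data.Maybe.Properties using (maybe′-map)
open import Algebra.Core using (Op₂)
open import Algebra.Morphism.Definitions using (Homomorphic₂)
open import Relation.Binary.PropositionalEquality using (_≡_; refl; sym; trans; cong; subst₂)
open import Relation.Unary using (Pred; _⊆_; _∩_; _∪_)

module _ {a b} {A : Set a} {B : Set b} {h : A → B} {_∙_ : Op₂ A} {_◦_ : Op₂ B}
         (homo : Homomorphic₂ A B _≡_ h _∙_ _◦_) where

  private
    maybe-∙-homo : ∀ x (m : Maybe A) →
      h (maybe′ (x ∙_) x m) ≡ maybe′ (h x ◦_) (h x) (Maybe.map h m)
    maybe-∙-homo x nothing  = refl
    maybe-∙-homo x (just y) = homo x y

  bigOp-homo : ∀ {k} (f : Fin k → A) (J : Subset k) →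
    Maybe.map h (bigOp _∙_ f J) ≡ bigOp _◦_ (h ∘ f) J
  bigOp-homo {zero}  f []            = refl
  bigOp-homo {suc k} f (outside ∷ J) = bigOp-homo (f ∘ suc) J
  bigOp-homo {suc k} f (inside ∷ J)  = cong just
    (trans (maybe-∙-homo (f zero) (bigOp _∙_ (f ∘ suc) J))
           (cong (maybe′ (h (f zero) ◦_) (h (f zero))) (bigOp-homo (f ∘ suc) J)))

  fold1-homo : ∀ {k} (f : Fin (suc k) → A) → h (fold1 _∙_ f) ≡ fold1 _◦_ (h ∘ f)
  fold1-homo {zero}  f = refl
  fold1-homo {suc k} f = trans (homo _ _) (cong (h (f zero) ◦_) (fold1-homo (f ∘ suc)))

record IsPowersetMorphism {a ℓL} (L : LatticeSig a ℓL) (S : Set)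
                          (h : LatticeSig.Carrier L → Pred S 0ℓ) : Set (a ⊔ ℓL ⊔ lsuc 0ℓ) where
  open LatticeSig L
  field
    ∧-homo   : Homomorphic₂ Carrier (Pred S 0ℓ) _≡_ h _∧_ _∩_
    ∨-homo   : Homomorphic₂ Carrier (Pred S 0ℓ) _≡_ h _∨_ _∪_
    monotone : ∀ {x y} → x ≤ y → h x ⊆ h y

module _ {c ℓ ℓ'} (R : OrderedCommRing c ℓ ℓ') where
  open OrderedCommRing R using (_*_; 0#) renaming (_≤_ to _≤R_; Carrier to ℝ)

  incExc-homo : ∀ {a b} {A : Set a} {B : Set b} {h : A → B} {_∙_ : Op₂ A} {_◦_ : Op₂ B} →
    Homomorphic₂ A B _≡_ h _∙_ _◦_ → (g : B → ℝ) {k : ℕ} (f : Fin k → A) →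
    incExc R _∙_ (g ∘ h) f ≡ incExc R _◦_ g (h ∘ f)
  incExc-homo {h = h} {_∙_} homo g {k} f = cong (foldr _ 0#) (map-cong summand (allSubsets k))
    where
    summand : ∀ J → maybe′ (λ x → sign R J * g (h x)) 0# (bigOp _∙_ f J)
                  ≡ maybe′ (λ y → sign R J * g y) 0# (bigOp _ (h ∘ f) J)
    summand J = trans (sym (maybe′-map (λ y → sign R J * g y) 0# h (bigOp _∙_ f J)))
                      (cong (maybe′ (λ y → sign R J * g y) 0#) (bigOp-homo homo f J))

  module _ {a ℓL} {L : LatticeSig a ℓL} {S : Set} {h : LatticeSig.Carrier L → Pred S 0ℓ}
           (isMorphism : IsPowersetMorphism L S h) {g : Pred S 0ℓ → ℝ} where
    open IsPowersetMorphism isMorphism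

    IsGeneralBelief-comap : IsGeneralBelief R (PowersetL S) g → IsGeneralBelief R L (g ∘ h)
    IsGeneralBelief-comap (inUnit , mono , incl-excl) =
        inUnit ∘ h
      , (λ x y x≤y → mono (h x) (h y) (monotone x≤y))
      , λ k f → subst₂ _≤R_ (sym (incExc-homo ∧-homo g f)) (cong g (sym (fold1-homo ∨-homo f)))
                       (incl-excl k (h ∘ f))

    IsGeneralPlausibility-comap : IsGeneralPlausibility R (PowersetL S) g →
      IsGeneralPlausibility R L (g ∘ h)
    IsGeneralPlausibility-comap (inUnit , mono , incl-excl) =
        inUnit ∘ h
      , (λ x y x≤y → mono (h x) (h y) (monotone x≤y))
      , λ k f → subst₂ _≤R_ (cong g (sym (fold1-homo ∧-homo f))) (sym (incExc-homo ∨-homo g f))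
                       (incl-excl k (h ∘ f))

module _ {n : ℕ} {S : Set} (v⁺ v⁻ : Fin n → Pred S 0ℓ) where

  sat⁺-isPowersetMorphism : IsPowersetMorphism (LindenbaumL n) S (sat⁺ v⁺ v⁻)
  sat⁺-isPowersetMorphism = record
    { ∧-homo   = λ _ _ → refl
    ; ∨-homo   = λ _ _ → refl
    ; monotone = λ φ⊢ψ → proj₁ (φ⊢ψ S v⁺ v⁻)
    }

  sat⁻-isPowersetMorphism : IsPowersetMorphism (LindenbaumOpL n) S (sat⁻ v⁺ v⁻)
  sat⁻-isPowersetMorphism = record
    { ∧-homo   = λ _ _ → refl
    ; ∨-homo   = λ _ _ → refl
    ; monotone = λ ψ⊢φ → proj₂ (ψ⊢φ S v⁺ v⁻)
    }

mainTheorem13 : ∀ {c ℓ ℓ'} (R : OrderedCommRing c ℓ ℓ') (n : ℕ) (M : DSplModel R n) →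
    IsGeneralBelief R (LindenbaumL n) (DSplModel.bel⁺ M)
    × IsGeneralPlausibility R (LindenbaumL n) (DSplModel.pl⁺ M)
    × IsGeneralBelief R (LindenbaumOpL n) (DSplModel.bel⁻ M)
    × IsGeneralPlausibility R (LindenbaumOpL n) (DSplModel.pl⁻ M)
mainTheorem13 R n M =
    IsGeneralBelief-comap R (sat⁺-isPowersetMorphism v⁺ v⁻) bel-gen
  , IsGeneralPlausibility-comap R (sat⁺-isPowersetMorphism v⁺ v⁻) pl-gen
  , IsGeneralBelief-comap R (sat⁻-isPowersetMorphism v⁺ v⁻) bel-gen
  , IsGeneralPlausibility-comap R (sat⁻-isPowersetMorphism v⁺ v⁻) pl-gen
  where open DSplModel M
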